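{- For every permutation $\pi$ (as in the context), $\left\lfloor\frac{b(\pi)}{2}\right\rfloor\le d'(\pi)\le b(\pi)-1$.
   Context: A permutation is $\pi=[\pi_0,\pi_1,\ldots,\pi_n,\pi_{n+1}]$ with $\pi_0=0$, $\pi_{n+1}=n+1$ and $(\pi_1,\ldots,\pi_n)$ a permutation of $\{1,\ldots,n\}$. A prefix reversal $\beta(1,j)$, $3\le j\le n+1$, gives $[\pi_0,\pi_{j-1},\ldots,\pi_1,\pi_j,\ldots,\pi_{n+1}]$. A prefix transposition $\tau(1,j,k)$, $2\le j\le n$, $j<k\le n+1$, gives $[\pi_0,\pi_j,\ldots,\pi_{k-1},\pi_1,\ldots,\pi_{j-1},\pi_k,\ldots,\pi_{n+1}]$. A prefix transreversal $\beta\tau(1,j,k)$, same ranges, gives $[\pi_0,\pi_j,\ldots,\pi_{k-1},\pi_{j-1},\ldots,\pi_1,\pi_k,\ldots,\pi_{n+1}]$. The identity has $\pi_i=i$ for all $i$. $d'(\pi)$ is the minimum number of operations (prefix reversals, prefix transpositions, prefix transreversals) transforming $\pi$ into the identity. Breakpoints: position $1$ is always a breakpoint; for $2\le i\le n+1$, position $i$ is a breakpoint iff $|\pi_i-\pi_{i-1}|\neq 1$. $b(\pi)$ is the number of breakpoints. -}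

module Defs where

open import Data.Nat using (ℕ; zero; suc; _+_; _∸_; _≤_; _<_; ∣_-_∣; _/_)
open import Data.Nat.Properties using (_≟_)
open import Data.List using (List; []; _∷_; _++_; take; drop; reverse; map; upTo; [_])
open import Data.List.Relation.Binary.Permutation.Propositional using (_↭_)
open import Data.Product using (_×_; Σ)
open import Relation.Nullary using (yes; no)
open import Relation.Binary.PropositionalEquality using (_≡_)

-- A permutation π = [0, π₁, …, πₙ, n+1] is represented by its inner part
-- xs = [π₁, …, πₙ]; the framing 0 and n+1 are implicit.
IsPerm : ℕ → List ℕ → Set
IsPerm n xs = xs ↭ map suc (upTo n)

identity : ℕ → List ℕ
identity n = map suc (upTo n)

data Step (n : ℕ) (xs : List ℕ) : List ℕ → Set where
  -- prefix reversal β(1,j), 3 ≤ j ≤ n+1 : reverse π₁ … π_{j-1}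
  rev   : (j : ℕ) → 3 ≤ j → j ≤ suc n →
          Step n xs (reverse (take (j ∸ 1) xs) ++ drop (j ∸ 1) xs)
  trans : (j k : ℕ) → 2 ≤ j → j ≤ n → j < k → k ≤ suc n →
          Step n xs (take (k ∸ j) (drop (j ∸ 1) xs)
                     ++ take (j ∸ 1) xs ++ drop (k ∸ 1) xs)
  transrev : (j k : ℕ) → 2 ≤ j → j ≤ n → j < k → k ≤ suc n →
          Step n xs (take (k ∸ j) (drop (j ∸ 1) xs)
                     ++ reverse (take (j ∸ 1) xs) ++ drop (k ∸ 1) xs)

data Reach (n : ℕ) : ℕ → List ℕ → List ℕ → Set where
  done : ∀ {xs} → Reach n zero xs xs
  step : ∀ {m xs ys zs} → Step n xs ys → Reach n m ys zs → Reach n (suc m) xs zs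

IsDist : ℕ → List ℕ → ℕ → Set
IsDist n xs d = Reach n d xs (identity n) × (∀ m → Reach n m xs (identity n) → d ≤ m)

nonAdjFrom : ℕ → List ℕ → ℕ
nonAdjFrom a [] = zero
nonAdjFrom a (b ∷ l) with ∣ a - b ∣ ≟ 1
... | yes _ = nonAdjFrom b l
... | no  _ = suc (nonAdjFrom b l)

nonAdj : List ℕ → ℕ
nonAdj [] = zero
nonAdj (a ∷ l) = nonAdjFrom a l

-- b(π): position 1 always counts; positions 2..n+1 count the pairs
-- (π_{i-1}, π_i) for i = 2..n+1, i.e. consecutive pairs of [π₁,…,πₙ,n+1].
breakpoints : ℕ → List ℕ → ℕ
breakpoints n xs = suc (nonAdj (xs ++ [ suc n ]))

module Submission where

-- Write L = π₁ ⋯ πₙ (n+1), so that b(π) − 1 = nonAdj L counts the consecutive pairs of L that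
-- are not adjacent values. Every operation turns a prefix A B of L into B A′, where A′ is A or its
-- reverse (B empty for a prefix reversal). Since position 1 is a breakpoint anyway, only two
-- junctions are cut and two are created, so a step lowers nonAdj L by at most 2 and
-- b(π) − 1 ≤ 2 d′(π).
--
-- Conversely, unless π is the identity some step lowers nonAdj L. Let S be the maximal strip (run
-- of consecutive values, increasing or decreasing) at the front of L and h its maximum; then S is
-- followed by a breakpoint and h + 1 lies further right. If h + 1 directly follows S, then S is
-- decreasing and reversing it suffices. Otherwise let x be the entry before h + 1. If x ≠ h + 2,
-- move S, oriented to end with h, in front of h + 1; if x = h + 2, the entry after h + 1 is not
-- adjacent to it, and S, oriented to start with h, goes right behind h + 1. Greedy sorting thus
-- needs at most b(π) − 1 steps, and a least number of steps exists because reachability in m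
-- steps is decidable.

open import Defs hiding (trans)
open import Data.Empty using (⊥; ⊥-elim)
open import Data.Unit using (⊤; tt)
open import Data.Sum using (_⊎_; inj₁; inj₂)
open import Data.Product using (Σ; ∃; ∃₂; _×_; _,_; proj₁; proj₂)
open import Data.Nat using (ℕ; zero; suc; _+_; _*_; _∸_; _≤_; _<_; _/_; z≤n; s≤s; ∣_-_∣)
open import Data.Nat.Properties
open import Data.Nat.DivMod using (m<n*o⇒m/o<n)
open import Data.Nat.Induction using (<-rec)
open import Data.Nat.Tactic.RingSolver using (solve-∀)
open import Data.List using (List; []; _∷_; _++_; [_]; reverse; take; drop; length; map; upTo; applyUpTo)
open import Data.List.Properties
  using ( ++-assoc; ++-identityʳ; ++-conicalʳ; ∷-injective; ∷-injectiveˡ; ∷ʳ-injectiveˡ; ∷ʳ-injectiveʳ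
        ; length-++; length-map; length-upTo; unfold-reverse; reverse-involutive
        ; take++drop≡id; drop-drop; map-applyUpTo; ≡-dec )
open import Data.List.Membership.Propositional using (_∈_)
open import Data.List.Membership.Propositional.Properties using (∈-++⁺ˡ; ∈-++⁺ʳ; ∈-++⁻; ∈-∃++)
open import Data.List.Relation.Unary.Any using (here; there)
import Data.List.Relation.Unary.All as All
open import Data.List.Relation.Unary.AllPairs using ([]; _∷_)
open import Data.List.Relation.Unary.Unique.Propositional using (Unique)
open import Data.List.Relation.Binary.Permutation.Propositional using (_↭_; ↭-refl; ↭-sym; ↭-trans; ↭⇒↭ₛ)
open import Data.List.Relation.Binary.Permutation.Propositional.Properties
  using (↭-reverse; ∈-resp-↭; ↭-length; ++⁺ˡ; ++⁺ʳ; shifts)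
open import Relation.Nullary using (¬_; Dec; yes; no)
open import Relation.Nullary.Decidable using (map′; _×-dec_; _⊎-dec_)
open import Relation.Binary.PropositionalEquality
  using (_≡_; _≢_; refl; sym; trans; cong; cong₂; subst; subst₂; setoid; module ≡-Reasoning)
open import Data.List.Relation.Binary.Permutation.Setoid.Properties (setoid ℕ) using (Unique-resp-↭)

breakpoint : ℕ → ℕ → ℕ
breakpoint x y = nonAdjFrom x [ y ]

Adjacent : ℕ → ℕ → Set
Adjacent x y = y ≡ suc x ⊎ x ≡ suc y

adjacent? : ∀ x y → Dec (Adjacent x y)
adjacent? x y = (y ≟ suc x) ⊎-dec (x ≟ suc y)

∣n-1+n∣≡1 : ∀ x → ∣ x - suc x ∣ ≡ 1
∣n-1+n∣≡1 zero = refl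
∣n-1+n∣≡1 (suc x) = ∣n-1+n∣≡1 x

∣m-n∣≡1⇒adjacent : ∀ x y → ∣ x - y ∣ ≡ 1 → Adjacent x y
∣m-n∣≡1⇒adjacent zero (suc y) eq = inj₁ eq
∣m-n∣≡1⇒adjacent (suc x) zero eq = inj₂ eq
∣m-n∣≡1⇒adjacent (suc x) (suc y) eq with ∣m-n∣≡1⇒adjacent x y eq
... | inj₁ p = inj₁ (cong suc p)
... | inj₂ p = inj₂ (cong suc p)

adjacent⇒∣m-n∣≡1 : ∀ {x y} → Adjacent x y → ∣ x - y ∣ ≡ 1
adjacent⇒∣m-n∣≡1 {x} (inj₁ refl) = ∣n-1+n∣≡1 x
adjacent⇒∣m-n∣≡1 {y = y} (inj₂ refl) = trans (∣-∣-comm (suc y) y) (∣n-1+n∣≡1 y)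

nonAdjFrom-∷ : ∀ x y l → nonAdjFrom x (y ∷ l) ≡ breakpoint x y + nonAdjFrom y l
nonAdjFrom-∷ x y l with ∣ x - y ∣ ≟ 1
... | yes _ = refl
... | no _ = refl

breakpoint-adjacent : ∀ {x y} → Adjacent x y → breakpoint x y ≡ 0
breakpoint-adjacent {x} {y} adj with ∣ x - y ∣ ≟ 1
... | yes _ = refl
... | no ≢1 = ⊥-elim (≢1 (adjacent⇒∣m-n∣≡1 adj))

breakpoint-¬adjacent : ∀ {x y} → ¬ Adjacent x y → breakpoint x y ≡ 1
breakpoint-¬adjacent {x} {y} ¬adj with ∣ x - y ∣ ≟ 1
... | yes ≡1 = ⊥-elim (¬adj (∣m-n∣≡1⇒adjacent x y ≡1))
... | no _ = refl

breakpoint≤1 : ∀ x y → breakpoint x y ≤ 1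
breakpoint≤1 x y with ∣ x - y ∣ ≟ 1
... | yes _ = z≤n
... | no _ = s≤s z≤n

breakpoint-comm : ∀ x y → breakpoint x y ≡ breakpoint y x
breakpoint-comm x y with ∣ x - y ∣ ≟ 1 | ∣ y - x ∣ ≟ 1
... | yes _ | yes _ = refl
... | no _  | no _  = refl
... | yes p | no q  = ⊥-elim (q (trans (∣-∣-comm y x) p))
... | no p  | yes q = ⊥-elim (p (trans (∣-∣-comm x y) q))

breakpoint-suc : ∀ x → breakpoint x (suc x) ≡ 0
breakpoint-suc x = breakpoint-adjacent {x} (inj₁ refl)

breakpoint-pred : ∀ x → breakpoint (suc x) x ≡ 0
breakpoint-pred x = breakpoint-adjacent {suc x} (inj₂ refl)

last : ℕ → List ℕ → ℕ
last x [] = x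
last x (y ∷ l) = last y l

last-∈ : ∀ x X → last x X ∈ x ∷ X
last-∈ x [] = here refl
last-∈ x (y ∷ Y) = there (last-∈ y Y)

nonAdjFrom-∷ʳ : ∀ x X y → nonAdjFrom x (X ++ [ y ]) ≡ nonAdjFrom x X + breakpoint (last x X) y
nonAdjFrom-∷ʳ x [] y = refl
nonAdjFrom-∷ʳ x (z ∷ Z) y = begin
    nonAdjFrom x (z ∷ Z ++ [ y ])
  ≡⟨ nonAdjFrom-∷ x z (Z ++ [ y ]) ⟩
    breakpoint x z + nonAdjFrom z (Z ++ [ y ])
  ≡⟨ cong (breakpoint x z +_) (nonAdjFrom-∷ʳ z Z y) ⟩
    breakpoint x z + (nonAdjFrom z Z + breakpoint (last z Z) y)
  ≡⟨ sym (+-assoc (breakpoint x z) _ _) ⟩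
    breakpoint x z + nonAdjFrom z Z + breakpoint (last z Z) y
  ≡⟨ cong (_+ breakpoint (last z Z) y) (sym (nonAdjFrom-∷ x z Z)) ⟩
    nonAdjFrom x (z ∷ Z) + breakpoint (last z Z) y
  ∎ where open ≡-Reasoning

nonAdj-++-∷ : ∀ X y Y → nonAdj (X ++ y ∷ Y) ≡ nonAdj (X ++ [ y ]) + nonAdj (y ∷ Y)
nonAdj-++-∷ [] y Y = refl
nonAdj-++-∷ (x ∷ []) y Y = nonAdjFrom-∷ x y Y
nonAdj-++-∷ (x ∷ z ∷ Z) y Y = begin
    nonAdjFrom x (z ∷ Z ++ y ∷ Y)
  ≡⟨ nonAdjFrom-∷ x z (Z ++ y ∷ Y) ⟩
    breakpoint x z + nonAdj (z ∷ Z ++ y ∷ Y)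
  ≡⟨ cong (breakpoint x z +_) (nonAdj-++-∷ (z ∷ Z) y Y) ⟩
    breakpoint x z + (nonAdj (z ∷ Z ++ [ y ]) + nonAdj (y ∷ Y))
  ≡⟨ sym (+-assoc (breakpoint x z) _ _) ⟩
    breakpoint x z + nonAdj (z ∷ Z ++ [ y ]) + nonAdj (y ∷ Y)
  ≡⟨ cong (_+ nonAdj (y ∷ Y)) (sym (nonAdjFrom-∷ x z (Z ++ [ y ]))) ⟩
    nonAdjFrom x (z ∷ Z ++ [ y ]) + nonAdj (y ∷ Y)
  ∎ where open ≡-Reasoning

nonAdj-∷ʳ-∷ʳ : ∀ X x y → nonAdj ((X ++ [ x ]) ++ [ y ]) ≡ nonAdj (X ++ [ x ]) + breakpoint x y
nonAdj-∷ʳ-∷ʳ X x y = trans (cong nonAdj (++-assoc X [ x ] [ y ])) (nonAdj-++-∷ X x [ y ])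

nonAdj-∷ʳ-≤ : ∀ X y → nonAdj (X ++ [ y ]) ≤ suc (nonAdj X)
nonAdj-∷ʳ-≤ [] y = z≤n
nonAdj-∷ʳ-≤ (x ∷ X) y = begin
    nonAdjFrom x (X ++ [ y ])
  ≡⟨ nonAdjFrom-∷ʳ x X y ⟩
    nonAdjFrom x X + breakpoint (last x X) y
  ≤⟨ +-monoʳ-≤ (nonAdjFrom x X) (breakpoint≤1 (last x X) y) ⟩
    nonAdjFrom x X + 1
  ≡⟨ +-comm (nonAdjFrom x X) 1 ⟩
    suc (nonAdjFrom x X)
  ∎ where open ≤-Reasoning

nonAdj-∷ʳ-≥ : ∀ X y → nonAdj X ≤ nonAdj (X ++ [ y ])
nonAdj-∷ʳ-≥ [] y = z≤n
nonAdj-∷ʳ-≥ (x ∷ X) y = subst (nonAdjFrom x X ≤_) (sym (nonAdjFrom-∷ʳ x X y)) (m≤m+n _ _)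

nonAdj-++-≥ : ∀ X Y → nonAdj X + nonAdj Y ≤ nonAdj (X ++ Y)
nonAdj-++-≥ X [] rewrite ++-identityʳ X = ≤-reflexive (+-identityʳ _)
nonAdj-++-≥ X (y ∷ Y) rewrite nonAdj-++-∷ X y Y = +-monoˡ-≤ (nonAdj (y ∷ Y)) (nonAdj-∷ʳ-≥ X y)

nonAdj-++-≤ : ∀ X Y → nonAdj (X ++ Y) ≤ suc (nonAdj X + nonAdj Y)
nonAdj-++-≤ X [] rewrite ++-identityʳ X | +-identityʳ (nonAdj X) = n≤1+n _
nonAdj-++-≤ X (y ∷ Y) rewrite nonAdj-++-∷ X y Y = +-monoˡ-≤ (nonAdj (y ∷ Y)) (nonAdj-∷ʳ-≤ X y)

nonAdj-reverse : ∀ X → nonAdj (reverse X) ≡ nonAdj X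
nonAdj-reverse [] = refl
nonAdj-reverse (y ∷ []) = refl
nonAdj-reverse (y ∷ x ∷ X) = begin
    nonAdj (reverse (y ∷ x ∷ X))
  ≡⟨ cong nonAdj (unfold-reverse y (x ∷ X)) ⟩
    nonAdj (reverse (x ∷ X) ++ [ y ])
  ≡⟨ cong (λ Z → nonAdj (Z ++ [ y ])) (unfold-reverse x X) ⟩
    nonAdj ((reverse X ++ [ x ]) ++ [ y ])
  ≡⟨ cong nonAdj (++-assoc (reverse X) [ x ] [ y ]) ⟩
    nonAdj (reverse X ++ x ∷ [ y ])
  ≡⟨ nonAdj-++-∷ (reverse X) x [ y ] ⟩
    nonAdj (reverse X ++ [ x ]) + breakpoint x y
  ≡⟨ cong (λ Z → nonAdj Z + breakpoint x y) (sym (unfold-reverse x X)) ⟩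
    nonAdj (reverse (x ∷ X)) + breakpoint x y
  ≡⟨ cong₂ _+_ (nonAdj-reverse (x ∷ X)) (breakpoint-comm x y) ⟩
    nonAdj (x ∷ X) + breakpoint y x
  ≡⟨ +-comm (nonAdj (x ∷ X)) (breakpoint y x) ⟩
    breakpoint y x + nonAdj (x ∷ X)
  ≡⟨ sym (nonAdjFrom-∷ y x X) ⟩
    nonAdj (y ∷ x ∷ X)
  ∎ where open ≡-Reasoning

-- Lower bound
++-assoc₃ : ∀ (A B C D : List ℕ) → (A ++ B ++ C) ++ D ≡ A ++ B ++ C ++ D
++-assoc₃ A B C D = trans (++-assoc A (B ++ C) D) (cong (A ++_) (++-assoc B C D))

nonAdj-exchange-≤ : ∀ A A′ B Z → nonAdj A′ ≡ nonAdj A →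
  nonAdj (A ++ B ++ Z) ≤ 2 + nonAdj (B ++ A′ ++ Z)
nonAdj-exchange-≤ A A′ B Z same-count = begin
    nonAdj (A ++ B ++ Z)
  ≤⟨ nonAdj-++-≤ A (B ++ Z) ⟩
    suc (nonAdj A + nonAdj (B ++ Z))
  ≤⟨ s≤s (+-monoʳ-≤ (nonAdj A) (nonAdj-++-≤ B Z)) ⟩
    suc (nonAdj A + suc (nonAdj B + nonAdj Z))
  ≡⟨ regroup (nonAdj A) (nonAdj B) (nonAdj Z) ⟩
    2 + (nonAdj B + (nonAdj A + nonAdj Z))
  ≡⟨ cong (λ a → 2 + (nonAdj B + (a + nonAdj Z))) (sym same-count) ⟩
    2 + (nonAdj B + (nonAdj A′ + nonAdj Z))
  ≤⟨ s≤s (s≤s (+-monoʳ-≤ (nonAdj B) (nonAdj-++-≥ A′ Z))) ⟩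
    2 + (nonAdj B + nonAdj (A′ ++ Z))
  ≤⟨ s≤s (s≤s (nonAdj-++-≥ B (A′ ++ Z))) ⟩
    2 + nonAdj (B ++ A′ ++ Z)
  ∎
  where
  open ≤-Reasoning
  regroup : ∀ a b c → suc (a + suc (b + c)) ≡ 2 + (b + (a + c))
  regroup = solve-∀

take-drop-split : ∀ i k (xs : List ℕ) → i ≤ k → xs ≡ take i xs ++ take (k ∸ i) (drop i xs) ++ drop k xs
take-drop-split i k xs i≤k = begin
    xs
  ≡⟨ sym (take++drop≡id i xs) ⟩
    take i xs ++ drop i xs
  ≡⟨ cong (take i xs ++_) (sym (take++drop≡id (k ∸ i) (drop i xs))) ⟩
    take i xs ++ take (k ∸ i) (drop i xs) ++ drop (k ∸ i) (drop i xs)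
  ≡⟨ cong (λ D → take i xs ++ take (k ∸ i) (drop i xs) ++ D) (drop-drop i (k ∸ i) xs) ⟩
    take i xs ++ take (k ∸ i) (drop i xs) ++ drop (i + (k ∸ i)) xs
  ≡⟨ cong (λ l → take i xs ++ take (k ∸ i) (drop i xs) ++ drop l xs) (m+[n∸m]≡n i≤k) ⟩
    take i xs ++ take (k ∸ i) (drop i xs) ++ drop k xs
  ∎ where open ≡-Reasoning

nonAdj-exchange-∷ʳ-≤ : ∀ {xs} A B C A′ z → xs ≡ A ++ B ++ C → nonAdj A′ ≡ nonAdj A →
  nonAdj (xs ++ [ z ]) ≤ 2 + nonAdj ((B ++ A′ ++ C) ++ [ z ])
nonAdj-exchange-∷ʳ-≤ A B C A′ z refl same-count
  rewrite ++-assoc₃ A B C [ z ] | ++-assoc₃ B A′ C [ z ] =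
  nonAdj-exchange-≤ A A′ B (C ++ [ z ]) same-count

nonAdj-step-≤ : ∀ {n xs ys} z → Step n xs ys → nonAdj (xs ++ [ z ]) ≤ 2 + nonAdj (ys ++ [ z ])
nonAdj-step-≤ {xs = xs} z (rev j _ _) =
  nonAdj-exchange-∷ʳ-≤ (take (j ∸ 1) xs) [] (drop (j ∸ 1) xs) (reverse (take (j ∸ 1) xs)) z
    (sym (take++drop≡id (j ∸ 1) xs)) (nonAdj-reverse (take (j ∸ 1) xs))
nonAdj-step-≤ {xs = xs} z (Step.trans (suc j) (suc k) _ _ (s≤s j<k) _) =
  nonAdj-exchange-∷ʳ-≤ (take j xs) (take (k ∸ j) (drop j xs)) (drop k xs) (take j xs) z
    (take-drop-split j k xs (<⇒≤ j<k)) refl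
nonAdj-step-≤ {xs = xs} z (transrev (suc j) (suc k) _ _ (s≤s j<k) _) =
  nonAdj-exchange-∷ʳ-≤ (take j xs) (take (k ∸ j) (drop j xs)) (drop k xs) (reverse (take j xs)) z
    (take-drop-split j k xs (<⇒≤ j<k)) (nonAdj-reverse (take j xs))

nonAdj-reach-≤ : ∀ {n m xs ys} z → Reach n m xs ys → nonAdj (xs ++ [ z ]) ≤ (m + m) + nonAdj (ys ++ [ z ])
nonAdj-reach-≤ z done = ≤-refl
nonAdj-reach-≤ {m = suc m} {xs} {ys} z (step {ys = xs′} s r) = begin
    nonAdj (xs ++ [ z ])
  ≤⟨ nonAdj-step-≤ z s ⟩
    2 + nonAdj (xs′ ++ [ z ])
  ≤⟨ s≤s (s≤s (nonAdj-reach-≤ z r)) ⟩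
    2 + (m + m + t)
  ≡⟨ cong (λ u → suc (u + t)) (sym (+-suc m m)) ⟩
    suc m + suc m + t
  ∎
  where
  open ≤-Reasoning
  t = nonAdj (ys ++ [ z ])

-- Existence of the distance
least-witness : ∀ {P : ℕ → Set} → (∀ m → Dec (P m)) → ∀ {u} → P u →
  ∃ λ d → P d × d ≤ u × (∀ m → P m → d ≤ m)
least-witness {P} P? {u} = <-rec Below go u
  where
  Below : ℕ → Set
  Below u = P u → ∃ λ d → P d × d ≤ u × (∀ m → P m → d ≤ m)
  go : ∀ u → (∀ {v} → v < u → Below v) → Below u
  go u smaller Pu with anyUpTo? P? u
  ... | yes (v , v<u , Pv) with smaller v<u Pv
  ...   | d , Pd , d≤v , least = d , Pd , ≤-trans d≤v (<⇒≤ v<u) , least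
  go u smaller Pu | no none = u , Pu , ≤-refl , λ m Pm → ≮⇒≥ (λ m<u → none (m , m<u , Pm))

reversal : ℕ → List ℕ → List ℕ
reversal j xs = reverse (take (j ∸ 1) xs) ++ drop (j ∸ 1) xs

transposition : ℕ → ℕ → List ℕ → List ℕ
transposition j k xs = take (k ∸ j) (drop (j ∸ 1) xs) ++ take (j ∸ 1) xs ++ drop (k ∸ 1) xs

transreversal : ℕ → ℕ → List ℕ → List ℕ
transreversal j k xs = take (k ∸ j) (drop (j ∸ 1) xs) ++ reverse (take (j ∸ 1) xs) ++ drop (k ∸ 1) xs

Reach? : ∀ n m xs zs → Dec (Reach n m xs zs)
Reach? n zero xs zs = map′ (λ { refl → done }) (λ { done → refl }) (≡-dec _≟_ xs zs)
Reach? n (suc m) xs zs =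
  map′ first-step-⇒ first-step-⇐ (by-reversal ⊎-dec by-transposition ⊎-dec by-transreversal)
  where
  bound = suc (suc n)
  Legal : ℕ → ℕ → Set
  Legal j k = 2 ≤ j × j ≤ n × j < k × k ≤ suc n
  legal? : ∀ j k → Dec (Legal j k)
  legal? j k = (2 ≤? j) ×-dec (j ≤? n) ×-dec (suc j ≤? k) ×-dec (k ≤? suc n)
  ByReversal ByTransposition ByTransreversal : Set
  ByReversal = ∃ λ j → j < bound × (3 ≤ j × j ≤ suc n) × Reach n m (reversal j xs) zs
  ByTransposition = ∃ λ j → j < bound × ∃ λ k → k < bound × Legal j k × Reach n m (transposition j k xs) zs
  ByTransreversal = ∃ λ j → j < bound × ∃ λ k → k < bound × Legal j k × Reach n m (transreversal j k xs) zs
  by-reversal : Dec ByReversal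
  by-reversal = anyUpTo? (λ j → ((3 ≤? j) ×-dec (j ≤? suc n)) ×-dec Reach? n m (reversal j xs) zs) bound
  by-transposition : Dec ByTransposition
  by-transposition =
    anyUpTo? (λ j → anyUpTo? (λ k → legal? j k ×-dec Reach? n m (transposition j k xs) zs) bound) bound
  by-transreversal : Dec ByTransreversal
  by-transreversal =
    anyUpTo? (λ j → anyUpTo? (λ k → legal? j k ×-dec Reach? n m (transreversal j k xs) zs) bound) bound
  first-step-⇒ : ByReversal ⊎ ByTransposition ⊎ ByTransreversal → Reach n (suc m) xs zs
  first-step-⇒ (inj₁ (j , _ , (3≤j , j≤) , r)) = step (rev j 3≤j j≤) r
  first-step-⇒ (inj₂ (inj₁ (j , _ , k , _ , (2≤j , j≤n , j<k , k≤) , r))) =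
    step (Step.trans j k 2≤j j≤n j<k k≤) r
  first-step-⇒ (inj₂ (inj₂ (j , _ , k , _ , (2≤j , j≤n , j<k , k≤) , r))) =
    step (transrev j k 2≤j j≤n j<k k≤) r
  first-step-⇐ : Reach n (suc m) xs zs → ByReversal ⊎ ByTransposition ⊎ ByTransreversal
  first-step-⇐ (step (rev j 3≤j j≤) r) = inj₁ (j , s≤s j≤ , (3≤j , j≤) , r)
  first-step-⇐ (step (Step.trans j k 2≤j j≤n j<k k≤) r) =
    inj₂ (inj₁ (j , s≤s (m≤n⇒m≤1+n j≤n) , k , s≤s k≤ , (2≤j , j≤n , j<k , k≤) , r))
  first-step-⇐ (step (transrev j k 2≤j j≤n j<k k≤) r) =
    inj₂ (inj₂ (j , s≤s (m≤n⇒m≤1+n j≤n) , k , s≤s k≤ , (2≤j , j≤n , j<k , k≤) , r))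

-- Runs of consecutive values
-- upFrom a k = [a, a+1, …, k-1+a] and downTo a k is its reverse
upFrom : ℕ → ℕ → List ℕ
upFrom a zero = []
upFrom a (suc k) = a ∷ upFrom (suc a) k

downTo : ℕ → ℕ → List ℕ
downTo a zero = []
downTo a (suc k) = k + a ∷ downTo a k

upFrom-∷ʳ : ∀ a k → upFrom a k ++ [ k + a ] ≡ upFrom a (suc k)
upFrom-∷ʳ a zero = refl
upFrom-∷ʳ a (suc k) =
  cong (a ∷_) (trans (cong (λ x → upFrom (suc a) k ++ [ x ]) (sym (+-suc k a))) (upFrom-∷ʳ (suc a) k))

downTo-∷ʳ : ∀ a k → downTo (suc a) k ++ [ a ] ≡ downTo a (suc k)
downTo-∷ʳ a zero = refl
downTo-∷ʳ a (suc k) = cong₂ _∷_ (+-suc k a) (downTo-∷ʳ a k)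

reverse-upFrom : ∀ a k → reverse (upFrom a k) ≡ downTo a k
reverse-upFrom a zero = refl
reverse-upFrom a (suc k) = begin
    reverse (a ∷ upFrom (suc a) k)
  ≡⟨ unfold-reverse a (upFrom (suc a) k) ⟩
    reverse (upFrom (suc a) k) ++ [ a ]
  ≡⟨ cong (_++ [ a ]) (reverse-upFrom (suc a) k) ⟩
    downTo (suc a) k ++ [ a ]
  ≡⟨ downTo-∷ʳ a k ⟩
    downTo a (suc k)
  ∎ where open ≡-Reasoning

reverse-downTo : ∀ a k → reverse (downTo a k) ≡ upFrom a k
reverse-downTo a k = trans (cong reverse (sym (reverse-upFrom a k))) (reverse-involutive (upFrom a k))

applyUpTo-upFrom : ∀ f k → (∀ i → f (suc i) ≡ suc (f i)) → applyUpTo f k ≡ upFrom (f 0) k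
applyUpTo-upFrom f zero f-suc = refl
applyUpTo-upFrom f (suc k) f-suc = cong (f 0 ∷_)
  (trans (applyUpTo-upFrom (λ i → f (suc i)) k (λ i → f-suc (suc i))) (cong (λ b → upFrom b k) (f-suc 0)))

identity-∷ʳ : ∀ n → identity n ++ [ suc n ] ≡ upFrom 1 (suc n)
identity-∷ʳ n = begin
    map suc (upTo n) ++ [ suc n ]
  ≡⟨ cong (_++ [ suc n ]) (trans (map-applyUpTo (λ i → i) suc n) (applyUpTo-upFrom suc n λ _ → refl)) ⟩
    upFrom 1 n ++ [ suc n ]
  ≡⟨ cong (λ x → upFrom 1 n ++ [ x ]) (+-comm 1 n) ⟩
    upFrom 1 n ++ [ n + 1 ]
  ≡⟨ upFrom-∷ʳ 1 n ⟩
    upFrom 1 (suc n)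
  ∎ where open ≡-Reasoning

length-upFrom : ∀ a k → length (upFrom a k) ≡ k
length-upFrom a zero = refl
length-upFrom a (suc k) = cong suc (length-upFrom (suc a) k)

∈-upFrom⁻ : ∀ {x} a k → x ∈ upFrom a k → a ≤ x × x < k + a
∈-upFrom⁻ a (suc k) (here refl) = ≤-refl , s≤s (m≤n+m a k)
∈-upFrom⁻ {x} a (suc k) (there x∈) with ∈-upFrom⁻ (suc a) k x∈
... | a<x , x< = <⇒≤ a<x , subst (x <_) (+-suc k a) x<

∈-upFrom⁺ : ∀ {i} a k → i < k → i + a ∈ upFrom a k
∈-upFrom⁺ {zero} a (suc k) _ = here refl
∈-upFrom⁺ {suc i} a (suc k) (s≤s i<k) =
  there (subst (_∈ upFrom (suc a) k) (+-suc i a) (∈-upFrom⁺ (suc a) k i<k))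

∈-downTo⁺ : ∀ {i} a k → i < k → i + a ∈ downTo a k
∈-downTo⁺ a k i<k =
  ∈-resp-↭ (subst (upFrom a k ↭_) (reverse-upFrom a k) (↭-sym (↭-reverse (upFrom a k)))) (∈-upFrom⁺ a k i<k)

upFrom-unique : ∀ a k → Unique (upFrom a k)
upFrom-unique a zero = []
upFrom-unique a (suc k) =
  All.tabulate (λ x∈ a≡x → <⇒≢ (proj₁ (∈-upFrom⁻ (suc a) k x∈)) a≡x) ∷ upFrom-unique (suc a) k

nonAdj-upFrom : ∀ a k → nonAdj (upFrom a k) ≡ 0
nonAdj-upFrom a zero = refl
nonAdj-upFrom a (suc zero) = refl
nonAdj-upFrom a (suc (suc k)) =
  trans (nonAdjFrom-∷ a (suc a) (upFrom (suc (suc a)) k))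
    (cong₂ _+_ (breakpoint-suc a) (nonAdj-upFrom (suc a) (suc k)))

nonAdj-upFrom-∷ʳ : ∀ a m y → nonAdj (upFrom a (suc m) ++ [ y ]) ≡ breakpoint (m + a) y
nonAdj-upFrom-∷ʳ a zero y = refl
nonAdj-upFrom-∷ʳ a (suc m) y = begin
    nonAdjFrom a (suc a ∷ upFrom (suc (suc a)) m ++ [ y ])
  ≡⟨ nonAdjFrom-∷ a (suc a) _ ⟩
    breakpoint a (suc a) + nonAdj (upFrom (suc a) (suc m) ++ [ y ])
  ≡⟨ cong₂ _+_ (breakpoint-suc a) (nonAdj-upFrom-∷ʳ (suc a) m y) ⟩
    breakpoint (m + suc a) y
  ≡⟨ cong (λ x → breakpoint x y) (+-suc m a) ⟩
    breakpoint (suc m + a) y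
  ∎ where open ≡-Reasoning

nonAdj-downTo-∷ʳ : ∀ a m y → nonAdj (downTo a (suc m) ++ [ y ]) ≡ breakpoint a y
nonAdj-downTo-∷ʳ a zero y = refl
nonAdj-downTo-∷ʳ a (suc m) y =
  trans (nonAdjFrom-∷ (suc m + a) (m + a) _) (cong₂ _+_ (breakpoint-pred (m + a)) (nonAdj-downTo-∷ʳ a m y))

perm-↭ : ∀ {n xs} → IsPerm n xs → xs ++ [ suc n ] ↭ upFrom 1 (suc n)
perm-↭ {n} {xs} p = subst (xs ++ [ suc n ] ↭_) (identity-∷ʳ n) (++⁺ʳ [ suc n ] p)

perm-length : ∀ {n xs} → IsPerm n xs → length xs ≡ n
perm-length {n} p = trans (↭-length p) (trans (length-map suc (upTo n)) (length-upTo n))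

perm-unique : ∀ {n xs} → IsPerm n xs → Unique (xs ++ [ suc n ])
perm-unique {n} p = Unique-resp-↭ (↭⇒↭ₛ (↭-sym (perm-↭ p))) (upFrom-unique 1 (suc n))

perm-bounded : ∀ {n xs x} → IsPerm n xs → x ∈ xs ++ [ suc n ] → 1 ≤ x × x ≤ suc n
perm-bounded {n} {x = x} p x∈ with ∈-upFrom⁻ 1 (suc n) (∈-resp-↭ (perm-↭ p) x∈)
... | 1≤x , x<n+2 = 1≤x , subst (x ≤_) (+-comm n 1) (≤-pred x<n+2)

perm-complete : ∀ {n xs k} → IsPerm n xs → 1 ≤ k → k ≤ suc n → k ∈ xs ++ [ suc n ]
perm-complete {n} {k = suc i} p _ (s≤s i≤n) =
  ∈-resp-↭ (↭-sym (perm-↭ p)) (subst (_∈ upFrom 1 (suc n)) (+-comm i 1) (∈-upFrom⁺ 1 (suc n) (s≤s i≤n)))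

unique-++-disjoint : ∀ A {B : List ℕ} {x} → Unique (A ++ B) → x ∈ A → x ∈ B → ⊥
unique-++-disjoint (a ∷ A) (a∉ ∷ _) (here refl) x∈B = All.lookup a∉ (∈-++⁺ʳ A x∈B) refl
unique-++-disjoint (a ∷ A) (_ ∷ u) (there x∈A) x∈B = unique-++-disjoint A u x∈A x∈B

unique-head-∉ : ∀ P {r R x} → Unique (P ++ r ∷ R) → x ∈ P → r ≢ x
unique-head-∉ P u x∈ r≡x = unique-++-disjoint P u x∈ (here (sym r≡x))

split-before-last : ∀ (A : List ℕ) {r R xs z} → A ++ r ∷ R ≡ xs ++ [ z ] →
  ∃ λ (C : List ℕ) → xs ≡ A ++ C × r ∷ R ≡ C ++ [ z ]
split-before-last [] {xs = xs} eq = xs , refl , eq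
split-before-last (a ∷ A) {xs = []} eq with ++-conicalʳ A _ (proj₂ (∷-injective eq))
... | ()
split-before-last (a ∷ A) {xs = x ∷ xs} eq with ∷-injective eq
... | refl , eq′ with split-before-last A eq′
...   | C , refl , rR≡ = C , refl , rR≡

-- Block moves
data Reorientation (A : List ℕ) : List ℕ → Set where
  keep : Reorientation A A
  flip : Reorientation A (reverse A)

reorientation-↭ : ∀ {A A′} → Reorientation A A′ → A′ ↭ A
reorientation-↭ keep = ↭-refl
reorientation-↭ {A} flip = ↭-reverse A

take-length-++ : ∀ (A D : List ℕ) → take (length A) (A ++ D) ≡ A
take-length-++ [] D = refl
take-length-++ (a ∷ A) D = cong (a ∷_) (take-length-++ A D)

drop-length-++ : ∀ (A D : List ℕ) → drop (length A) (A ++ D) ≡ D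
drop-length-++ [] D = refl
drop-length-++ (a ∷ A) D = drop-length-++ A D

transposition-step : ∀ {n} A B C {A′} → length (A ++ B ++ C) ≡ n → 1 ≤ length A → 1 ≤ length B →
  Reorientation A A′ → Step n (A ++ B ++ C) (B ++ A′ ++ C)
transposition-step {n} A B C {A′} len 1≤A 1≤B o =
  subst (Step n xs) (cong₂ (λ X Y → X ++ A′ ++ Y) moved-B rest-C) (by o)
  where
  xs = A ++ B ++ C
  a = length A
  b = length B
  a+b≤n : a + b ≤ n
  a+b≤n = subst (a + b ≤_) (trans (sym (trans (length-++ A) (cong (a +_) (length-++ B)))) len)
            (+-monoʳ-≤ a (m≤m+n b (length C)))
  a<a+b : a < a + b
  a<a+b = m<m+n a 1≤B
  moved-B : take (suc (a + b) ∸ suc a) (drop a xs) ≡ B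
  moved-B = trans (cong₂ take (m+n∸m≡n a b) (drop-length-++ A (B ++ C))) (take-length-++ B C)
  rest-C : drop (a + b) xs ≡ C
  rest-C = trans (sym (drop-drop a b xs)) (trans (cong (drop b) (drop-length-++ A (B ++ C))) (drop-length-++ B C))
  by : Reorientation A A′ → Step n xs (take (suc (a + b) ∸ suc a) (drop a xs) ++ A′ ++ drop (a + b) xs)
  by keep = subst (λ X → Step n xs (take (a + b ∸ a) (drop a xs) ++ X ++ drop (a + b) xs))
    (take-length-++ A (B ++ C))
    (Step.trans (suc a) (suc (a + b)) (s≤s 1≤A) (≤-trans a<a+b a+b≤n) (s≤s a<a+b) (s≤s a+b≤n))
  by flip = subst (λ X → Step n xs (take (a + b ∸ a) (drop a xs) ++ reverse X ++ drop (a + b) xs))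
    (take-length-++ A (B ++ C))
    (transrev (suc a) (suc (a + b)) (s≤s 1≤A) (≤-trans a<a+b a+b≤n) (s≤s a<a+b) (s≤s a+b≤n))

reversal-step : ∀ {n} A C → length (A ++ C) ≡ n → 2 ≤ length A → Step n (A ++ C) (reverse A ++ C)
reversal-step {n} A C len 2≤A =
  subst (Step n (A ++ C)) (cong₂ (λ X Y → reverse X ++ Y) (take-length-++ A C) (drop-length-++ A C))
    (rev (suc (length A)) (s≤s 2≤A) (s≤s (subst (length A ≤_) (trans (sym (length-++ A)) len) (m≤m+n _ _))))

Improvement : ℕ → List ℕ → Set
Improvement n xs = ∃ λ ys → Step n xs ys × IsPerm n ys × nonAdj (ys ++ [ suc n ]) < nonAdj (xs ++ [ suc n ])

improve-by-transposition : ∀ {n xs} → IsPerm n xs → ∀ A B {A′ t T} → xs ++ [ suc n ] ≡ A ++ B ++ t ∷ T →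
  1 ≤ length A → 1 ≤ length B → Reorientation A A′ →
  nonAdj (B ++ A′ ++ t ∷ T) < nonAdj (A ++ B ++ t ∷ T) → Improvement n xs
improve-by-transposition {n} p A B {A′} {t} {T} eq 1≤A 1≤B o fewer
  with split-before-last (A ++ B) (trans (++-assoc A B (t ∷ T)) (sym eq))
... | C , refl , tT≡ = B ++ A′ ++ C , step′ , perm′ , fewer′
  where
  abc : (A ++ B) ++ C ≡ A ++ B ++ C
  abc = ++-assoc A B C
  step′ : Step n ((A ++ B) ++ C) (B ++ A′ ++ C)
  step′ = subst (λ xs → Step n xs _) (sym abc)
    (transposition-step A B C (trans (cong length (sym abc)) (perm-length p)) 1≤A 1≤B o)
  perm′ : IsPerm n (B ++ A′ ++ C)
  perm′ = ↭-trans (↭-trans (++⁺ˡ B (++⁺ʳ C (reorientation-↭ o))) (shifts B A))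
    (subst (_↭ identity n) abc p)
  fewer′ : nonAdj ((B ++ A′ ++ C) ++ [ suc n ]) < nonAdj (((A ++ B) ++ C) ++ [ suc n ])
  fewer′ = subst₂ (λ X Y → nonAdj X < nonAdj Y)
    (trans (cong (λ Z → B ++ A′ ++ Z) tT≡) (sym (++-assoc₃ B A′ C [ suc n ]))) (sym eq) fewer

improve-by-reversal : ∀ {n xs} → IsPerm n xs → ∀ A {t T} → xs ++ [ suc n ] ≡ A ++ t ∷ T → 2 ≤ length A →
  nonAdj (reverse A ++ t ∷ T) < nonAdj (A ++ t ∷ T) → Improvement n xs
improve-by-reversal {n} p A {t} {T} eq 2≤A fewer with split-before-last A (sym eq)
... | C , refl , tT≡ = reverse A ++ C , reversal-step A C (perm-length p) 2≤A , perm′ , fewer′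
  where
  perm′ : IsPerm n (reverse A ++ C)
  perm′ = ↭-trans (++⁺ʳ C (↭-reverse A)) p
  fewer′ : nonAdj ((reverse A ++ C) ++ [ suc n ]) < nonAdj ((A ++ C) ++ [ suc n ])
  fewer′ = subst₂ (λ X Y → nonAdj X < nonAdj Y)
    (trans (cong (reverse A ++_) tT≡) (sym (++-assoc (reverse A) C [ suc n ]))) (sym eq) fewer

-- Strips
-- Strip a m S e: S lists a, …, m + a in increasing or (with at least two entries) decreasing order, and ends in e
data Strip (a : ℕ) : ℕ → List ℕ → ℕ → Set where
  ascending : ∀ {m} → Strip a m (upFrom a (suc m)) (m + a)
  descending : ∀ {m} → Strip a (suc m) (downTo a (suc (suc m))) a

strip-∷ʳ : ∀ {a m S e} → Strip a m S e → ∀ y → nonAdj (S ++ [ y ]) ≡ breakpoint e y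
strip-∷ʳ {a} {m} ascending y = nonAdj-upFrom-∷ʳ a m y
strip-∷ʳ {a} (descending {m}) y = nonAdj-downTo-∷ʳ a (suc m) y

strip-++-∷ : ∀ {a m S e} → Strip a m S e → ∀ y Y →
  nonAdj (S ++ y ∷ Y) ≡ breakpoint e y + nonAdj (y ∷ Y)
strip-++-∷ {S = S} s y Y = trans (nonAdj-++-∷ S y Y) (cong (_+ nonAdj (y ∷ Y)) (strip-∷ʳ s y))

strip-↭ : ∀ {a m S e} → Strip a m S e → S ↭ upFrom a (suc m)
strip-↭ ascending = ↭-refl
strip-↭ {a} (descending {m}) =
  subst (_↭ upFrom a (suc (suc m))) (reverse-upFrom a (suc (suc m))) (↭-reverse (upFrom a (suc (suc m))))

strip-≤ : ∀ {a m S e x} → Strip a m S e → x ∈ S → x ≤ m + a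
strip-≤ {a} {m} s x∈ = ≤-pred (proj₂ (∈-upFrom⁻ a (suc m) (∈-resp-↭ (strip-↭ s) x∈)))

strip-∋ : ∀ {a m S e} → Strip a m S e → m + a ∈ S
strip-∋ {a} {m} s = ∈-resp-↭ (↭-sym (strip-↭ s)) (∈-upFrom⁺ a (suc m) ≤-refl)

strip-length : ∀ {a m S e} → Strip a m S e → 1 ≤ length S
strip-length ascending = s≤s z≤n
strip-length descending = s≤s z≤n

strip-to-upFrom : ∀ {a m S e} → Strip a m S e → Reorientation S (upFrom a (suc m))
strip-to-upFrom ascending = keep
strip-to-upFrom {a} (descending {m}) = subst (Reorientation _) (reverse-downTo a (suc (suc m))) flip

strip-to-downTo : ∀ {a m S e} → Strip a m S e → Reorientation S (downTo a (suc m))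
strip-to-downTo {a} {m} ascending = subst (Reorientation _) (reverse-upFrom a (suc m)) flip
strip-to-downTo descending = keep

OnHead : (ℕ → Set) → List ℕ → Set
OnHead P [] = ⊤
OnHead P (r ∷ _) = P r

BreakAfter : ℕ → List ℕ → Set
BreakAfter e = OnHead (λ r → breakpoint e r ≡ 1)

data StripSplit (L : List ℕ) : Set where
  strip-split : ∀ {a m e S rest} → Strip a m S e → L ≡ S ++ rest → BreakAfter e rest → StripSplit L

ascending-prefix : ∀ x l → ∃₂ λ m rest → x ∷ l ≡ upFrom x (suc m) ++ rest × OnHead (_≢ suc (m + x)) rest
ascending-prefix x [] = 0 , [] , refl , tt
ascending-prefix x (y ∷ l) with y ≟ suc x
... | no y≢ = 0 , y ∷ l , refl , y≢
... | yes refl with ascending-prefix (suc x) l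
...   | m , rest , eq , head≢ =
    suc m , rest , cong (x ∷_) eq , subst (λ v → OnHead (_≢ suc v) rest) (+-suc m x) head≢

descending-prefix : ∀ x l →
  ∃₂ λ a m → ∃ λ rest → x ∷ l ≡ downTo a (suc m) ++ rest × OnHead (λ r → a ≢ suc r) rest
descending-prefix x [] = x , 0 , [] , refl , tt
descending-prefix x (y ∷ l) with x ≟ suc y
... | no x≢ = x , 0 , y ∷ l , refl , x≢
... | yes refl with descending-prefix y l
...   | a , m , rest , eq , head≢ = a , suc m , rest , cong₂ _∷_ (cong suc (∷-injectiveˡ eq)) eq , head≢

first-strip : ∀ x l → Unique (x ∷ l) → StripSplit (x ∷ l)
first-strip x l u with ascending-prefix x l
... | m , [] , eq , _ = strip-split {m = m} {rest = []} ascending eq tt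
... | suc m , r ∷ R , eq , r≢ =
    strip-split {m = suc m} {rest = r ∷ R} ascending eq (breakpoint-¬adjacent ¬adjacent)
  where
  ¬adjacent : ¬ Adjacent (suc m + x) r
  ¬adjacent (inj₁ r≡) = r≢ r≡
  ¬adjacent (inj₂ e≡) = unique-head-∉ (upFrom x (suc (suc m))) (subst Unique eq u)
    (∈-upFrom⁺ x (suc (suc m)) (m≤n⇒m≤1+n ≤-refl)) (sym (suc-injective e≡))
... | zero , r ∷ R , refl , r≢ with x ≟ suc r
...   | no x≢ = strip-split {m = 0} {rest = r ∷ R} ascending refl
      (breakpoint-¬adjacent λ { (inj₁ r≡) → r≢ r≡ ; (inj₂ x≡) → x≢ x≡ })
...   | yes refl with descending-prefix r R
...     | a , m , rest , eq , head≢ =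
        strip-split {m = suc m} {rest = rest} descending eq′ (maximal rest eq′ head≢)
  where
  eq′ : suc r ∷ r ∷ R ≡ downTo a (suc (suc m)) ++ rest
  eq′ = cong₂ _∷_ (cong suc (∷-injectiveˡ eq)) eq
  maximal : ∀ rest → suc r ∷ r ∷ R ≡ downTo a (suc (suc m)) ++ rest → OnHead (λ r → a ≢ suc r) rest →
    BreakAfter a rest
  maximal [] _ _ = tt
  maximal (r′ ∷ _) eq″ a≢ = breakpoint-¬adjacent λ
    { (inj₁ r′≡) → unique-head-∉ (downTo a (suc (suc m))) (subst Unique eq″ u)
        (∈-downTo⁺ a (suc (suc m)) (s≤s (s≤s z≤n))) r′≡
    ; (inj₂ a≡) → a≢ a≡ }

strip-whole : ∀ {n xs a m S e} → IsPerm n xs → Strip a m S e → xs ++ [ suc n ] ≡ S → xs ≡ identity n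
strip-whole {n} {xs} {a} {m} p ascending eq = ∷ʳ-injectiveˡ xs (identity n) (begin
    xs ++ [ suc n ]
  ≡⟨ eq ⟩
    upFrom a (suc m)
  ≡⟨ cong₂ (λ b k → upFrom b (suc k)) a≡1 m≡n ⟩
    upFrom 1 (suc n)
  ≡⟨ sym (identity-∷ʳ n) ⟩
    identity n ++ [ suc n ]
  ∎)
  where
  open ≡-Reasoning
  a≡1 : a ≡ 1
  a≡1 = ≤-antisym (proj₁ (∈-upFrom⁻ a (suc m) (subst (1 ∈_) eq (perm-complete p ≤-refl (s≤s z≤n)))))
                  (proj₁ (perm-bounded p (subst (a ∈_) (sym eq) (here refl))))
  m≡n : m ≡ n
  m≡n = suc-injective (begin
      suc m                    ≡⟨ sym (length-upFrom a (suc m)) ⟩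
      length (upFrom a (suc m)) ≡⟨ cong length (sym eq) ⟩
      length (xs ++ [ suc n ]) ≡⟨ length-++ xs ⟩
      length xs + 1            ≡⟨ cong (_+ 1) (perm-length p) ⟩
      n + 1                    ≡⟨ +-comm n 1 ⟩
      suc n                    ∎)
strip-whole {n} {xs} {a} p (descending {m}) eq = ⊥-elim (1+n≰n (≤-trans a<head head≤a))
  where
  a<head : a < suc m + a
  a<head = s≤s (m≤n+m a m)
  head≤a : suc m + a ≤ a
  head≤a = subst (suc m + a ≤_)
    (∷ʳ-injectiveʳ xs (downTo (suc a) (suc m)) (trans eq (sym (downTo-∷ʳ a (suc m)))))
    (proj₂ (perm-bounded p (subst (suc m + a ∈_) (sym eq) (here refl))))

-- Upper bound
nonAdj-strip-move-< : ∀ {a m S e} → Strip a m S e → ∀ p P u U f t T → breakpoint e p ≡ 1 →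
  (∀ y → nonAdj ((u ∷ U) ++ [ y ]) ≡ breakpoint f y) →
  nonAdj ((p ∷ P) ++ [ u ]) + breakpoint f t ≤ nonAdj ((p ∷ P) ++ [ t ]) →
  nonAdj ((p ∷ P) ++ (u ∷ U) ++ t ∷ T) < nonAdj (S ++ (p ∷ P) ++ t ∷ T)
nonAdj-strip-move-< {S = S} {e} s p P u U f t T broken count-U joins = begin-strict
    nonAdj ((p ∷ P) ++ (u ∷ U) ++ t ∷ T)
  ≡⟨ nonAdj-++-∷ (p ∷ P) u (U ++ t ∷ T) ⟩
    nonAdj ((p ∷ P) ++ [ u ]) + nonAdj ((u ∷ U) ++ t ∷ T)
  ≡⟨ cong (nonAdj ((p ∷ P) ++ [ u ]) +_) (trans (nonAdj-++-∷ (u ∷ U) t T) (cong (_+ N) (count-U t))) ⟩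
    nonAdj ((p ∷ P) ++ [ u ]) + (breakpoint f t + N)
  ≡⟨ sym (+-assoc _ (breakpoint f t) N) ⟩
    nonAdj ((p ∷ P) ++ [ u ]) + breakpoint f t + N
  ≤⟨ +-monoˡ-≤ N joins ⟩
    nonAdj ((p ∷ P) ++ [ t ]) + N
  <⟨ n<1+n _ ⟩
    1 + (nonAdj ((p ∷ P) ++ [ t ]) + N)
  ≡⟨ cong₂ _+_ (sym broken) (sym (nonAdj-++-∷ (p ∷ P) t T)) ⟩
    breakpoint e p + nonAdj ((p ∷ P) ++ t ∷ T)
  ≡⟨ sym (strip-++-∷ s p (P ++ t ∷ T)) ⟩
    nonAdj (S ++ (p ∷ P) ++ t ∷ T)
  ∎
  where
  open ≤-Reasoning
  N = nonAdj (t ∷ T)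

reverse-strip-improves : ∀ {n xs a m S e T} → IsPerm n xs → Strip a m S e →
  xs ++ [ suc n ] ≡ S ++ suc (m + a) ∷ T → breakpoint e (suc (m + a)) ≡ 1 → Improvement n xs
reverse-strip-improves {a = a} {m} p ascending eq broken =
  ⊥-elim (0≢1+n (trans (sym (breakpoint-suc (m + a))) broken))
reverse-strip-improves {a = a} {T = T} p (descending {m}) eq broken =
  improve-by-reversal p (downTo a (suc (suc m))) eq (s≤s (s≤s z≤n)) (begin-strict
      nonAdj (reverse (downTo a (suc (suc m))) ++ t ∷ T)
    ≡⟨ cong (λ X → nonAdj (X ++ t ∷ T)) (reverse-downTo a (suc (suc m))) ⟩
      nonAdj (upFrom a (suc (suc m)) ++ t ∷ T)
    ≡⟨ strip-++-∷ (ascending {a} {suc m}) t T ⟩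
      breakpoint (suc m + a) t + N
    ≡⟨ cong (_+ N) (breakpoint-suc (suc m + a)) ⟩
      N
    <⟨ n<1+n N ⟩
      1 + N
    ≡⟨ cong (_+ N) (sym broken) ⟩
      breakpoint a t + N
    ≡⟨ sym (strip-++-∷ (descending {a} {m}) t T) ⟩
      nonAdj (downTo a (suc (suc m)) ++ t ∷ T)
    ∎)
  where
  open ≤-Reasoning
  t = suc (suc m + a)
  N = nonAdj (t ∷ T)

strip-max≤n : ∀ {n xs a m S e r R} → IsPerm n xs → Strip a m S e → xs ++ [ suc n ] ≡ S ++ r ∷ R →
  m + a ≤ n
strip-max≤n {n} {xs} {a} {m} {S} {r = r} {R} p s eq with split-before-last S (sym eq)
... | C , _ , rR≡ =
    ≤-pred (≤∧≢⇒< (proj₂ (perm-bounded p (subst (m + a ∈_) (sym eq) (∈-++⁺ˡ (strip-∋ s))))) max≢n+1)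
  where
  max≢n+1 : m + a ≢ suc n
  max≢n+1 max≡ = unique-++-disjoint S (subst Unique eq (perm-unique p)) (strip-∋ s)
    (subst (_∈ r ∷ R) (sym max≡) (subst (suc n ∈_) (sym rR≡) (∈-++⁺ʳ C (here refl))))

successor-after-strip : ∀ {n xs a m S e r R} → IsPerm n xs → Strip a m S e → xs ++ [ suc n ] ≡ S ++ r ∷ R →
  suc (m + a) ∈ r ∷ R
successor-after-strip {a = a} {m} {S} p s eq
  with ∈-++⁻ S (subst (suc (m + a) ∈_) eq (perm-complete p (s≤s z≤n) (s≤s (strip-max≤n p s eq))))
... | inj₁ ∈S = ⊥-elim (1+n≰n (strip-≤ s ∈S))
... | inj₂ ∈rest = ∈rest

move-before-successor : ∀ {n xs a m S e} b B T → IsPerm n xs → Strip a m S e →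
  xs ++ [ suc n ] ≡ S ++ (b ∷ B) ++ suc (m + a) ∷ T → breakpoint e b ≡ 1 →
  ¬ Adjacent (last b B) (suc (m + a)) → Improvement n xs
move-before-successor {a = a} {m} {S} b B T p s eq broken ¬adjacent =
  improve-by-transposition p S (b ∷ B) eq (strip-length s) (s≤s z≤n) (strip-to-upFrom s)
    (nonAdj-strip-move-< s b B a (upFrom (suc a) m) hi (suc hi) T broken (nonAdj-upFrom-∷ʳ a m) joins)
  where
  open ≤-Reasoning
  hi = m + a
  joins : nonAdj ((b ∷ B) ++ [ a ]) + breakpoint hi (suc hi) ≤ nonAdj ((b ∷ B) ++ [ suc hi ])
  joins = begin
      nonAdj ((b ∷ B) ++ [ a ]) + breakpoint hi (suc hi)
    ≡⟨ trans (cong (nonAdj ((b ∷ B) ++ [ a ]) +_) (breakpoint-suc hi)) (+-identityʳ _) ⟩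
      nonAdj ((b ∷ B) ++ [ a ])
    ≤⟨ nonAdj-∷ʳ-≤ (b ∷ B) a ⟩
      1 + nonAdj (b ∷ B)
    ≡⟨ +-comm 1 _ ⟩
      nonAdj (b ∷ B) + 1
    ≡⟨ cong (nonAdj (b ∷ B) +_) (sym (breakpoint-¬adjacent ¬adjacent)) ⟩
      nonAdj (b ∷ B) + breakpoint (last b B) (suc hi)
    ≡⟨ sym (nonAdjFrom-∷ʳ b B (suc hi)) ⟩
      nonAdj ((b ∷ B) ++ [ suc hi ])
    ∎

move-after-successor : ∀ {n xs a m S e} b B T → IsPerm n xs → Strip a m S e →
  xs ++ [ suc n ] ≡ S ++ (b ∷ B) ++ suc (m + a) ∷ T → breakpoint e b ≡ 1 →
  last b B ≡ suc (suc (m + a)) → Improvement n xs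
move-after-successor {n} {xs} {a} {m} {S} b B [] p s eq broken last≡ =
  ⊥-elim (1+n≰n (subst (suc (suc (m + a)) ≤_) n+1≡ last≤n+1))
  where
  last≤n+1 : suc (suc (m + a)) ≤ suc n
  last≤n+1 = proj₂ (perm-bounded p (subst (_∈ xs ++ [ suc n ]) last≡
    (subst (last b B ∈_) (sym eq) (∈-++⁺ʳ S (∈-++⁺ˡ (last-∈ b B))))))
  n+1≡ : suc n ≡ suc (m + a)
  n+1≡ = ∷ʳ-injectiveʳ xs (S ++ b ∷ B) (trans eq (sym (++-assoc S (b ∷ B) [ suc (m + a) ])))
move-after-successor {n} {xs} {a} {m} {S} b B (r ∷ R) p s eq broken last≡ =
  improve-by-transposition p S (b ∷ B ++ [ suc hi ]) eq′ (strip-length s) (s≤s z≤n) (strip-to-downTo s)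
    (nonAdj-strip-move-< s b (B ++ [ suc hi ]) hi (downTo a m) a r R broken (nonAdj-downTo-∷ʳ a m) joins)
  where
  open ≤-Reasoning
  hi = m + a
  eq′ : xs ++ [ suc n ] ≡ S ++ (b ∷ B ++ [ suc hi ]) ++ r ∷ R
  eq′ = trans eq (cong (S ++_) (sym (++-assoc (b ∷ B) [ suc hi ] (r ∷ R))))
  ¬adjacent : ¬ Adjacent (suc hi) r
  ¬adjacent (inj₁ r≡) = unique-++-disjoint (S ++ b ∷ B)
    (subst Unique (trans eq (sym (++-assoc S (b ∷ B) _))) (perm-unique p))
    (∈-++⁺ʳ S (subst (_∈ b ∷ B) (trans last≡ (sym r≡)) (last-∈ b B))) (there (here refl))
  ¬adjacent (inj₂ hi+1≡) = unique-++-disjoint S (subst Unique eq (perm-unique p))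
    (subst (_∈ S) (suc-injective hi+1≡) (strip-∋ s)) (∈-++⁺ʳ (b ∷ B) (there (here refl)))
  P = b ∷ B ++ [ suc hi ]
  joins : nonAdj (P ++ [ hi ]) + breakpoint a r ≤ nonAdj (P ++ [ r ])
  joins = begin
      nonAdj (P ++ [ hi ]) + breakpoint a r
    ≡⟨ cong (_+ breakpoint a r)
         (trans (nonAdj-∷ʳ-∷ʳ (b ∷ B) (suc hi) hi) (cong (nonAdj P +_) (breakpoint-pred hi))) ⟩
      nonAdj P + 0 + breakpoint a r
    ≤⟨ +-monoʳ-≤ (nonAdj P + 0) (breakpoint≤1 a r) ⟩
      nonAdj P + 0 + 1
    ≡⟨ cong (_+ 1) (+-identityʳ (nonAdj P)) ⟩
      nonAdj P + 1
    ≡⟨ cong (nonAdj P +_) (sym (breakpoint-¬adjacent ¬adjacent)) ⟩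
      nonAdj P + breakpoint (suc hi) r
    ≡⟨ sym (nonAdj-∷ʳ-∷ʳ (b ∷ B) (suc hi) r) ⟩
      nonAdj (P ++ [ r ])
    ∎

strip-move : ∀ {n xs a m S e r R} → IsPerm n xs → Strip a m S e → xs ++ [ suc n ] ≡ S ++ r ∷ R →
  breakpoint e r ≡ 1 → Improvement n xs
strip-move {n} {xs} {a} {m} {S} {e} p s eq broken with ∈-∃++ (successor-after-strip p s eq)
... | B , T , rR≡ = relocate B T (trans eq (cong (S ++_) rR≡)) (subst (BreakAfter e) rR≡ broken)
  where
  relocate : ∀ B T → xs ++ [ suc n ] ≡ S ++ B ++ suc (m + a) ∷ T → BreakAfter e (B ++ suc (m + a) ∷ T) →
    Improvement n xs
  relocate [] T eq′ broken′ = reverse-strip-improves p s eq′ broken′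
  relocate (b ∷ B) T eq′ broken′ with adjacent? (last b B) (suc (m + a))
  ... | no ¬adjacent = move-before-successor b B T p s eq′ broken′ ¬adjacent
  ... | yes (inj₂ last≡) = move-after-successor b B T p s eq′ broken′ last≡
  ... | yes (inj₁ max+1≡) = ⊥-elim (unique-++-disjoint S (subst Unique eq′ (perm-unique p)) (strip-∋ s)
    (∈-++⁺ˡ (subst (_∈ b ∷ B) (suc-injective (sym max+1≡)) (last-∈ b B))))

improvable : ∀ {n xs} → IsPerm n xs → xs ≡ identity n ⊎ Improvement n xs
improvable {n} {xs} p = from-first-strip (xs ++ [ suc n ]) refl
  where
  from-first-strip : ∀ L → xs ++ [ suc n ] ≡ L → xs ≡ identity n ⊎ Improvement n xs
  from-first-strip [] eq with () ← ++-conicalʳ xs [ suc n ] eq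
  from-first-strip (x ∷ l) eq with first-strip x l (subst Unique eq (perm-unique p))
  ... | strip-split {rest = []} s split _ = inj₁ (strip-whole p s (trans eq (trans split (++-identityʳ _))))
  ... | strip-split {rest = r ∷ R} s split broken = inj₂ (strip-move p s (trans eq split) broken)

sort-greedily : ∀ {n xs} → IsPerm n xs → ∃ λ u → u ≤ nonAdj (xs ++ [ suc n ]) × Reach n u xs (identity n)
sort-greedily {n} p = <-rec Sortable sort _ p refl
  where
  Sortable : ℕ → Set
  Sortable k = ∀ {xs} → IsPerm n xs → nonAdj (xs ++ [ suc n ]) ≡ k →
    ∃ λ u → u ≤ k × Reach n u xs (identity n)
  sort : ∀ k → (∀ {j} → j < k → Sortable j) → Sortable k
  sort _ sortable p refl with improvable p
  ... | inj₁ refl = 0 , z≤n , done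
  ... | inj₂ (ys , s , q , fewer) with sortable fewer q refl
  ...   | u , u≤ , r = suc u , ≤-trans (s≤s u≤) fewer , step s r

1+m/2≤n : ∀ {m n} → m ≤ n + n → suc m / 2 ≤ n
1+m/2≤n {m} {n} m≤2n = ≤-pred (m<n*o⇒m/o<n {suc m} {suc n} {2} (s≤s (s≤s (subst (m ≤_) 2n≡n*2 m≤2n))))
  where
  2n≡n*2 : n + n ≡ n * 2
  2n≡n*2 = trans (cong (n +_) (sym (+-identityʳ n))) (*-comm 2 n)

theorem4 : (n : ℕ) (xs : List ℕ) → IsPerm n xs →
    Σ ℕ (λ d → IsDist n xs d ×
    (breakpoints n xs / 2 ≤ d × d ≤ breakpoints n xs ∸ 1))
theorem4 n xs p with sort-greedily p
... | u , u≤b-1 , sorts-in-u with least-witness (λ m → Reach? n m xs (identity n)) sorts-in-u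
...   | d , sorts-in-d , d≤u , minimal = d , (sorts-in-d , minimal) , 1+m/2≤n b-1≤2d , ≤-trans d≤u u≤b-1
  where
  sorted-count : nonAdj (identity n ++ [ suc n ]) ≡ 0
  sorted-count = trans (cong nonAdj (identity-∷ʳ n)) (nonAdj-upFrom 1 (suc n))
  b-1≤2d : nonAdj (xs ++ [ suc n ]) ≤ d + d
  b-1≤2d = subst (nonAdj (xs ++ [ suc n ]) ≤_) (trans (cong (d + d +_) sorted-count) (+-identityʳ (d + d)))
    (nonAdj-reach-≤ (suc n) sorts-in-d)
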